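{- Let $G$ be a graph that has an efficient edge dominating set. Then $G$ is chordal if and only if $G$ is dually chordal.
   Context: All graphs are finite, simple and undirected. An edge set $M\subseteq E$ is an efficient edge dominating set of $G=(V,E)$ if for every edge $e\in E$ there is exactly one $e'\in M$ with $e\cap e'\neq\emptyset$ (equivalently, $M$ is an efficient dominating set in the line graph of $G$). A graph is chordal if it has no induced cycle of length at least 4. For a vertex $v$, $N[v]$ is its closed neighborhood; a vertex $u\in N[v]$ is a maximum neighbor of $v$ if $N[w]\subseteq N[u]$ for all $w\in N[v]$. An ordering $(v_1,\ldots,v_n)$ of $V$ is a maximum neighborhood ordering if each $v_i$ has a maximum neighbor in $G[\{v_i,\ldots,v_n\}]$; $G$ is dually chordal if it has a maximum neighborhood ordering. -}

module Defs where

open import Data.Nat using (ℕ; suc; _+_; _%_)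
open import Data.Fin using (Fin; toℕ; _≤_)
open import Data.Fin.Permutation using (Permutation′; _⟨$⟩ʳ_; _⟨$⟩ˡ_)
open import Data.Bool using (Bool; true)
open import Data.Product using (Σ; _×_; ∃-syntax)
open import Data.Sum using (_⊎_)
open import Relation.Binary.PropositionalEquality using (_≡_)
open import Relation.Nullary using (¬_)
open import Function using (_⇔_)
open import Function.Definitions using (Injective)

record Graph (n : ℕ) : Set where
  field
    adj     : Fin n → Fin n → Bool
    sym     : ∀ x y → adj x y ≡ adj y x
    irrefl  : ∀ x → ¬ (adj x x ≡ true)

open Graph public

module _ {n : ℕ} (G : Graph n) where

  Adj : Fin n → Fin n → Set
  Adj x y = adj G x y ≡ true

  InClosedNbhd : Fin n → Fin n → Set
  InClosedNbhd x y = x ≡ y ⊎ Adj x y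

  -- Efficient edge domination.
  -- An edge is represented by an (ordered) pair of adjacent vertices;
  -- the edge set M is a symmetric Boolean relation contained in adj.

  Meets : Fin n → Fin n → Fin n → Fin n → Set
  Meets u v x y = u ≡ x ⊎ u ≡ y ⊎ v ≡ x ⊎ v ≡ y

  SameEdge : Fin n → Fin n → Fin n → Fin n → Set
  SameEdge x y x' y' = (x ≡ x' × y ≡ y') ⊎ (x ≡ y' × y ≡ x')

  record IsEfficientEdgeDominatingSet (M : Fin n → Fin n → Bool) : Set where
    field
      M-sym    : ∀ x y → M x y ≡ M y x
      M⊆E      : ∀ x y → M x y ≡ true → Adj x y
      exists   : ∀ u v → Adj u v →
                 Σ (Fin n) λ x → Σ (Fin n) λ y → M x y ≡ true × Meets u v x y
      unique   : ∀ u v → Adj u v → ∀ x y x' y' →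
                 M x y ≡ true → Meets u v x y →
                 M x' y' ≡ true → Meets u v x' y' →
                 SameEdge x y x' y'

  HasEfficientEdgeDominatingSet : Set
  HasEfficientEdgeDominatingSet =
    Σ (Fin n → Fin n → Bool) IsEfficientEdgeDominatingSet

  -- i and j are consecutive on the cycle 0,1,…,k-1,0 (k = m+4)
  CycAdj : (m : ℕ) → Fin (suc (suc (suc (suc m)))) → Fin (suc (suc (suc (suc m)))) → Set
  CycAdj m i j = (suc (toℕ i) % suc (suc (suc (suc m))) ≡ toℕ j)
               ⊎ (suc (toℕ j) % suc (suc (suc (suc m))) ≡ toℕ i)

  IsInducedCycle : (m : ℕ) → (Fin (suc (suc (suc (suc m)))) → Fin n) → Set
  IsInducedCycle m c = Injective _≡_ _≡_ c × (∀ i j → Adj (c i) (c j) ⇔ CycAdj m i j)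

  Chordal : Set
  Chordal = ¬ (Σ ℕ λ m → Σ (Fin (suc (suc (suc (suc m)))) → Fin n) λ c → IsInducedCycle m c)

  -- Dual chordality via maximum neighborhood orderings.
  -- An ordering is a permutation π; v_i = π ⟨$⟩ʳ i.  A vertex x lies in
  -- G_i = G[{v_i,…,v_n}] iff its position π ⟨$⟩ˡ x is ≥ i.

  module _ (π : Permutation′ n) where

    InSuffix : Fin n → Fin n → Set
    InSuffix i x = i ≤ (π ⟨$⟩ˡ x)

    IsMaxNeighborInSuffix : Fin n → Fin n → Set
    IsMaxNeighborInSuffix i u =
      InSuffix i u × InClosedNbhd u (π ⟨$⟩ʳ i) ×
      (∀ w → InSuffix i w → InClosedNbhd w (π ⟨$⟩ʳ i) →
        ∀ z → InSuffix i z → InClosedNbhd z w → InClosedNbhd z u)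

  IsMaxNeighborhoodOrdering : Permutation′ n → Set
  IsMaxNeighborhoodOrdering π = ∀ i → ∃[ u ] IsMaxNeighborInSuffix π i u

  DuallyChordal : Set
  DuallyChordal = Σ (Permutation′ n) IsMaxNeighborhoodOrdering

module Submission where

-- Such an M is an induced matching whose complement is
-- independent; everything below uses only three consequences of this
-- (EdgeDomination): neighbours of unmatched vertices are matched, partners
-- are unique, and adjacent matched vertices are partners.  Hence two
-- adjacent vertices with two distinct common neighbours are partners.
--
-- Dually chordal ⇒ chordal: let v be the vertex of an induced cycle that
-- comes first in a maximum neighbourhood ordering.  Its maximum neighbour u
-- sees v, both cycle neighbours a, b of v and the next vertex a' after a,
-- which the matching facts forbid (no-dominated-fan).
--
-- Chordal ⇒ dually chordal: it suffices that every nonempty vertex set T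
-- contains a vertex with a maximum neighbour in G[T] (MaxNeighbourhoodOrderings
-- then removes such vertices one by one).  If no vertex of T had one, every
-- induced path of G[T] could be extended by a vertex (ChordalHasMaxNeighbours,
-- using chordality through ChordalPaths.lastEarlierNeighbour), contradicting
-- that induced paths have fewer than n edges.

open import Defs hiding (sym)
open import Data.Nat using (ℕ; zero; suc; _+_; _∸_; _%_; _<_; _≤_; z≤n; s≤s; NonZero; _≟_; _≤?_; _<?_)
open import Data.Nat.Properties
open import Data.Nat.DivMod using (%-distribˡ-+; m%n%n≡m%n; m%n<n; m<n⇒m%n≡m; [m+n]%n≡m%n; n%n≡0)
open import Data.Fin using (Fin; toℕ; fromℕ<) renaming (zero to fzero; suc to fsuc; _≤_ to _≤ᶠ_)
open import Data.Fin.Properties using (toℕ-injective; toℕ-fromℕ<; toℕ<n; pigeonhole; any?; all?) renaming (_≟_ to _≟ᶠ_)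
open import Data.Fin.Permutation using (_⟨$⟩ˡ_; inverseʳ; permutation)
open import Data.Fin.Subset using (Subset; _∈_; _∉_; _-_; ∣_∣; ⊤; inside; outside)
open import Data.Fin.Subset.Properties using (_∈?_; nonempty?; Empty-unique; ∣⊥∣≡0; ∣⊤∣≡n; ∈⊤; p─⊥≡p; p─q⊆p; x∈p∧x≢y⇒x∈p-y; drop-there)
open import Data.Vec using (_∷_; here; there)
open import Data.Bool using (Bool; true)
open import Data.Bool.Properties using () renaming (_≟_ to _≟ᵇ_)
open import Data.Product using (Σ; ∃; _×_; _,_; proj₁; proj₂)
open import Data.Sum using (_⊎_; inj₁; inj₂; [_,_]′)
open import Data.Sum.Base as Sum using ()
open import Data.Empty using (⊥; ⊥-elim)
open import Relation.Binary.Definitions using (tri<; tri≈; tri>)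
open import Relation.Binary.PropositionalEquality
open import Relation.Nullary using (¬_; Dec; yes; no)
open import Relation.Nullary.Decidable using (_×-dec_; _→-dec_; _⊎-dec_)
open import Function using (_⇔_; mk⇔; Equivalence)

suc-% : ∀ x K .{{_ : NonZero K}} → suc (x % K) % K ≡ suc x % K
suc-% x K = begin
  (1 + x % K) % K          ≡⟨ %-distribˡ-+ 1 (x % K) K ⟩
  (1 % K + x % K % K) % K  ≡⟨ cong (λ t → (1 % K + t) % K) (m%n%n≡m%n x K) ⟩
  (1 % K + x % K) % K      ≡⟨ sym (%-distribˡ-+ 1 x K) ⟩
  (1 + x) % K              ∎
  where open ≡-Reasoning

-- A residue a < K is changed by adding any 0 < d < K: either a + d < K is
-- the new residue, or a + d ∸ K is, and a + d ∸ K ≡ a would force d ≡ K.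
residue-+-≢ : ∀ {a d K} .{{_ : NonZero K}} → a < K → 0 < d → d < K → a ≢ (a + d) % K
residue-+-≢ {a} {d} {K} a<K 0<d d<K a≡ with a + d <? K
... | yes a+d<K = <⇒≢ (m<m+n a 0<d) (trans a≡ (m<n⇒m%n≡m a+d<K))
... | no a+d≮K = <⇒≢ d<K (sym (+-cancelˡ-≡ a K d wrap))
  where
  open ≡-Reasoning
  K≤a+d : K ≤ a + d
  K≤a+d = ≮⇒≥ a+d≮K
  a+d∸K<K : a + d ∸ K < K
  a+d∸K<K = subst (a + d ∸ K <_) (m+n∸n≡m K K) (∸-monoˡ-< (+-mono-< a<K d<K) K≤a+d)
  wrap : a + K ≡ a + d
  wrap = begin
    a + K              ≡⟨ cong (_+ K) a≡ ⟩
    (a + d) % K + K    ≡⟨ cong (λ t → t % K + K) (sym (m∸n+n≡m K≤a+d)) ⟩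
    (a + d ∸ K + K) % K + K ≡⟨ cong (_+ K) ([m+n]%n≡m%n (a + d ∸ K) K) ⟩
    (a + d ∸ K) % K + K ≡⟨ cong (_+ K) (m<n⇒m%n≡m a+d∸K<K) ⟩
    a + d ∸ K + K      ≡⟨ m∸n+n≡m K≤a+d ⟩
    a + d              ∎

%-distinct : ∀ r {s t} K .{{_ : NonZero K}} → s < t → t < s + K → (r + s) % K ≢ (r + t) % K
%-distinct r {s} {t} K s<t t<s+K eq =
  residue-+-≢ (m%n<n (r + s) K) (m<n⇒0<n∸m s<t) d<K (begin
    (r + s) % K                    ≡⟨ eq ⟩
    (r + t) % K                    ≡⟨ cong (_% K) r+t≡ ⟩
    (r + s + d) % K                ≡⟨ %-distribˡ-+ (r + s) d K ⟩
    ((r + s) % K + d % K) % K      ≡⟨ cong (λ x → ((r + s) % K + x) % K) (m<n⇒m%n≡m d<K) ⟩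
    ((r + s) % K + d) % K          ∎)
  where
  open ≡-Reasoning
  d = t ∸ s
  s+d≡t : s + d ≡ t
  s+d≡t = m+[n∸m]≡n (<⇒≤ s<t)
  r+t≡ : r + t ≡ r + s + d
  r+t≡ = trans (cong (r +_) (sym s+d≡t)) (sym (+-assoc r s d))
  d<K : d < K
  d<K = +-cancelˡ-< s d K (subst (_< s + K) (sym s+d≡t) t<s+K)

Follows : ℕ → ℕ → ℕ → Set
Follows last a b = suc a ≡ b ⊎ (a ≡ last × b ≡ 0)

suc%⇔Follows : ∀ {last a b} → a ≤ last → b ≤ last → (suc a % suc last ≡ b) ⇔ Follows last a b
suc%⇔Follows {last} {a} {b} a≤last b≤last = mk⇔ to from
  where
  to : suc a % suc last ≡ b → Follows last a b
  to eq with suc a <? suc last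
  ... | yes a<last = inj₁ (trans (sym (m<n⇒m%n≡m a<last)) eq)
  ... | no a≮last = inj₂ (a≡last , trans (sym eq) (trans (cong (_% suc last) (cong suc a≡last)) (n%n≡0 (suc last))))
    where
    a≡last : a ≡ last
    a≡last = ≤-antisym a≤last (≤-pred (≮⇒≥ a≮last))
  from : Follows last a b → suc a % suc last ≡ b
  from (inj₁ refl) = m<n⇒m%n≡m (s≤s b≤last)
  from (inj₂ (refl , refl)) = n%n≡0 (suc last)

argmin : ∀ {k} (g : Fin (suc k) → ℕ) → Σ (Fin (suc k)) λ j → ∀ j' → g j ≤ g j'
argmin {zero} g = fzero , λ { fzero → ≤-refl }
argmin {suc k} g with argmin (λ j → g (fsuc j))
... | j , min with g fzero ≤? g (fsuc j)
...   | yes g0≤ = fzero , λ { fzero → ≤-refl ; (fsuc j') → ≤-trans g0≤ (min j') }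
...   | no g0≰ = fsuc j , λ { fzero → <⇒≤ (≰⇒> g0≰) ; (fsuc j') → min j' }

<-suc-split : ∀ {j b} → j < suc b → j < b ⊎ j ≡ b
<-suc-split j<1+b = m≤n⇒m<n∨m≡n (≤-pred j<1+b)

≤-suc-split : ∀ {j k} → j ≤ suc k → j ≤ k ⊎ j ≡ suc k
≤-suc-split j≤1+k with m≤n⇒m<n∨m≡n j≤1+k
... | inj₁ j<1+k = inj₁ (≤-pred j<1+k)
... | inj₂ j≡1+k = inj₂ j≡1+k

lastBelow : {P : ℕ → Set} → (∀ j → Dec (P j)) → ∀ b →
            (∀ j → j < b → ¬ P j) ⊎
            ∃ λ j → j < b × P j × (∀ j' → j < j' → j' < b → ¬ P j')
lastBelow P? zero = inj₁ λ j ()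
lastBelow P? (suc b) with P? b
... | yes Pb = inj₂ (b , ≤-refl , Pb , λ j' b<j' j'<1+b _ → <-irrefl refl (≤-trans j'<1+b b<j'))
... | no ¬Pb with lastBelow P? b
...   | inj₁ none = inj₁ λ j j<1+b → [ none j , (λ { refl → ¬Pb }) ]′ (<-suc-split j<1+b)
...   | inj₂ (j , j<b , Pj , last) =
        inj₂ (j , m≤n⇒m≤1+n j<b , Pj , λ j' j<j' j'<1+b → [ last j' j<j' , (λ { refl → ¬Pb }) ]′ (<-suc-split j'<1+b))

snoc : {A : Set} → (ℕ → A) → ℕ → A → ℕ → A
snoc f k z j with j ≟ k
... | yes _ = z
... | no _ = f j

snoc-new : {A : Set} (f : ℕ → A) (k : ℕ) (z : A) → snoc f k z k ≡ z
snoc-new f k z with k ≟ k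
... | yes _ = refl
... | no k≢k = ⊥-elim (k≢k refl)

snoc-old : {A : Set} (f : ℕ → A) {k : ℕ} (z : A) {j : ℕ} → j < k → snoc f k z j ≡ f j
snoc-old f {k} z {j} j<k with j ≟ k
... | yes j≡k = ⊥-elim (<⇒≢ j<k j≡k)
... | no _ = refl

x∉p-x : ∀ {n} (x : Fin n) (p : Subset n) → x ∉ p - x
x∉p-x fzero (s ∷ p) ()
x∉p-x (fsuc x) (s ∷ p) x∈ = x∉p-x x p (drop-there x∈)

∣p∣≡1+∣p-x∣ : ∀ {n} {x : Fin n} {p : Subset n} → x ∈ p → ∣ p ∣ ≡ suc ∣ p - x ∣
∣p∣≡1+∣p-x∣ {p = inside ∷ p} here = cong suc (sym (cong ∣_∣ (p─⊥≡p p)))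
∣p∣≡1+∣p-x∣ {p = inside ∷ p} (there x∈p) = cong suc (∣p∣≡1+∣p-x∣ x∈p)
∣p∣≡1+∣p-x∣ {p = outside ∷ p} (there x∈p) = ∣p∣≡1+∣p-x∣ x∈p

module GraphNotation {n : ℕ} (G : Graph n) where
  infix 4 _~_ _∈N[_]

  _~_ : Fin n → Fin n → Set
  _~_ = Adj G

  ~-sym : ∀ {x y} → x ~ y → y ~ x
  ~-sym {x} {y} x~y = trans (Graph.sym G y x) x~y

  ~-irrefl : ∀ {x y} → x ~ y → x ≢ y
  ~-irrefl {x} x~x refl = Graph.irrefl G x x~x

  _~?_ : ∀ x y → Dec (x ~ y)
  x ~? y = adj G x y ≟ᵇ true

  _∈N[_] : Fin n → Fin n → Set
  _∈N[_] = InClosedNbhd G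

  _∈N?[_] : ∀ z u → Dec (z ∈N[ u ])
  z ∈N?[ u ] = (z ≟ᶠ u) ⊎-dec (z ~? u)

  ∈N-separated⇒~ : ∀ {u z w} → z ∈N[ u ] → w ∈N[ u ] → w ≢ z → ¬ w ~ z → u ~ z
  ∈N-separated⇒~ (inj₂ z~u) _ _ _ = ~-sym z~u
  ∈N-separated⇒~ (inj₁ refl) (inj₁ w≡u) w≢z _ = ⊥-elim (w≢z w≡u)
  ∈N-separated⇒~ (inj₁ refl) (inj₂ w~u) _ w≁z = ⊥-elim (w≁z w~u)

  MaxNeighbourIn : (Fin n → Set) → Fin n → Fin n → Set
  MaxNeighbourIn S v u =
    S u × u ∈N[ v ] × (∀ w → S w → w ∈N[ v ] → ∀ z → S z → z ∈N[ w ] → z ∈N[ u ])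

  HasMaxNeighbourIn : (Fin n → Set) → Fin n → Set
  HasMaxNeighbourIn S v = ∃ (MaxNeighbourIn S v)

  HasMaxNeighbourIn-cong : ∀ {S S' v} → (∀ x → S x → S' x) → (∀ x → S' x → S x) →
                           HasMaxNeighbourIn S v → HasMaxNeighbourIn S' v
  HasMaxNeighbourIn-cong S⊆S' S'⊆S (u , Su , u∈Nv , max) =
    u , S⊆S' u Su , u∈Nv , λ w S'w w∈Nv z S'z z∈Nw → max w (S'⊆S w S'w) w∈Nv z (S'⊆S z S'z) z∈Nw

  pendant⇒max : ∀ {S v q} → S q → v ~ q → (∀ s → S s → v ~ s → s ≡ q) → MaxNeighbourIn S v q
  pendant⇒max {S} {v} {q} Sq v~q only = Sq , inj₂ (~-sym v~q) , dominated
    where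
    dominated : ∀ w → S w → w ∈N[ v ] → ∀ z → S z → z ∈N[ w ] → z ∈N[ q ]
    dominated w Sw (inj₁ refl) z Sz (inj₁ refl) = inj₂ v~q
    dominated w Sw (inj₁ refl) z Sz (inj₂ z~v) = inj₁ (only z Sz (~-sym z~v))
    dominated w Sw (inj₂ w~v) z Sz z∈Nw = subst (z ∈N[_]) (only w Sw (~-sym w~v)) z∈Nw

  isolated⇒max : ∀ {S v} → S v → (∀ s → S s → ¬ v ~ s) → MaxNeighbourIn S v v
  isolated⇒max {S} {v} Sv none = Sv , inj₁ refl , dominated
    where
    dominated : ∀ w → S w → w ∈N[ v ] → ∀ z → S z → z ∈N[ w ] → z ∈N[ v ]
    dominated w Sw (inj₁ refl) z Sz z∈Nw = z∈Nw
    dominated w Sw (inj₂ w~v) z Sz z∈Nw = ⊥-elim (none w Sw (~-sym w~v))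

module InducedPaths {n : ℕ} (G : Graph n) where
  open GraphNotation G

  -- An induced path  at 0, at 1, …, at k  in G[T]  (k edges, k + 1 vertices).
  record InducedPath (T : Subset n) (k : ℕ) : Set where
    field
      at        : ℕ → Fin n
      at∈       : ∀ j → j ≤ k → at j ∈ T
      at-inj    : ∀ i j → i ≤ k → j ≤ k → at i ≡ at j → i ≡ j
      at-adj    : ∀ i → i < k → at i ~ at (suc i)
      at-nonadj : ∀ i j → j ≤ k → suc i < j → ¬ at i ~ at j

  open InducedPath public

  private
    variable
      T : Subset n
      k : ℕ

  OffPath : InducedPath T k → Fin n → Set
  OffPath {k = k} P z = ∀ j → j ≤ k → at P j ≢ z

  adj⇒consecutive : (P : InducedPath T k) → ∀ {i j} → i ≤ k → j ≤ k → at P i ~ at P j →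
                    suc i ≡ j ⊎ suc j ≡ i
  adj⇒consecutive P {i} {j} i≤k j≤k i~j with <-cmp i j
  ... | tri≈ _ refl _ = ⊥-elim (~-irrefl i~j refl)
  ... | tri< i<j _ _ with m≤n⇒m<n∨m≡n i<j
  ...   | inj₁ 1+i<j = ⊥-elim (at-nonadj P i j j≤k 1+i<j i~j)
  ...   | inj₂ 1+i≡j = inj₁ 1+i≡j
  adj⇒consecutive P {i} {j} i≤k j≤k i~j | tri> _ _ j<i with m≤n⇒m<n∨m≡n j<i
  ...   | inj₁ 1+j<i = ⊥-elim (at-nonadj P j i i≤k 1+j<i (~-sym i~j))
  ...   | inj₂ 1+j≡i = inj₂ 1+j≡i

  truncate : InducedPath T k → ∀ j → j ≤ k → InducedPath T j
  truncate P j j≤k = record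
    { at        = at P
    ; at∈       = λ i i≤j → at∈ P i (≤-trans i≤j j≤k)
    ; at-inj    = λ a b a≤j b≤j → at-inj P a b (≤-trans a≤j j≤k) (≤-trans b≤j j≤k)
    ; at-adj    = λ i i<j → at-adj P i (<-≤-trans i<j j≤k)
    ; at-nonadj = λ a b b≤j → at-nonadj P a b (≤-trans b≤j j≤k) }

  truncate-offPath : (P : InducedPath T k) → ∀ {j z} (j≤k : j ≤ k) → OffPath P z → OffPath (truncate P j j≤k) z
  truncate-offPath P j≤k off t t≤j = off t (≤-trans t≤j j≤k)

  extend : (P : InducedPath T k) (z : Fin n) → z ∈ T → OffPath P z → at P k ~ z →
           (∀ j → j < k → ¬ at P j ~ z) → InducedPath T (suc k)
  extend {T} {k} P z z∈T off k~z only = record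
    { at        = at'
    ; at∈       = at∈'
    ; at-inj    = at-inj'
    ; at-adj    = at-adj'
    ; at-nonadj = at-nonadj' }
    where
    at' = snoc (at P) (suc k) z
    old : ∀ {j} → j ≤ k → at' j ≡ at P j
    old j≤k = snoc-old (at P) z (s≤s j≤k)
    new : at' (suc k) ≡ z
    new = snoc-new (at P) (suc k) z
    at∈' : ∀ j → j ≤ suc k → at' j ∈ T
    at∈' j j≤1+k with ≤-suc-split j≤1+k
    ... | inj₁ j≤k = subst (_∈ T) (sym (old j≤k)) (at∈ P j j≤k)
    ... | inj₂ refl = subst (_∈ T) (sym new) z∈T
    at-inj' : ∀ i j → i ≤ suc k → j ≤ suc k → at' i ≡ at' j → i ≡ j
    at-inj' i j i≤1+k j≤1+k eq with ≤-suc-split i≤1+k | ≤-suc-split j≤1+k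
    ... | inj₁ i≤k | inj₁ j≤k = at-inj P i j i≤k j≤k (trans (sym (old i≤k)) (trans eq (old j≤k)))
    ... | inj₁ i≤k | inj₂ refl = ⊥-elim (off i i≤k (trans (sym (old i≤k)) (trans eq new)))
    ... | inj₂ refl | inj₁ j≤k = ⊥-elim (off j j≤k (trans (sym (old j≤k)) (trans (sym eq) new)))
    ... | inj₂ refl | inj₂ refl = refl
    at-adj' : ∀ i → i < suc k → at' i ~ at' (suc i)
    at-adj' i i<1+k with <-suc-split i<1+k
    ... | inj₁ i<k = subst₂ _~_ (sym (old (<⇒≤ i<k))) (sym (old i<k)) (at-adj P i i<k)
    ... | inj₂ refl = subst₂ _~_ (sym (old ≤-refl)) (sym new) k~z
    at-nonadj' : ∀ i j → j ≤ suc k → suc i < j → ¬ at' i ~ at' j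
    at-nonadj' i j j≤1+k 1+i<j with ≤-suc-split j≤1+k
    ... | inj₁ j≤k = λ i~j → at-nonadj P i j j≤k 1+i<j
                               (subst₂ _~_ (old (≤-trans (n≤1+n i) (≤-trans (<⇒≤ 1+i<j) j≤k))) (old j≤k) i~j)
    ... | inj₂ refl = λ i~z → only i (≤-pred 1+i<j) (subst₂ _~_ (old (≤-pred (<⇒≤ 1+i<j))) new i~z)

  extend-old : ∀ (P : InducedPath T k) z z∈T off k~z only {j} → j ≤ k →
               at (extend P z z∈T off k~z only) j ≡ at P j
  extend-old P z _ _ _ _ j≤k = snoc-old (at P) z (s≤s j≤k)

  extend-new : ∀ (P : InducedPath T k) z z∈T off k~z only →
               at (extend P z z∈T off k~z only) (suc k) ≡ z
  extend-new {k = k} P z _ _ _ _ = snoc-new (at P) (suc k) z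

  dropFirst : InducedPath T k → ∀ j → j ≤ k → InducedPath T (k ∸ j)
  dropFirst {T} {k} P j j≤k = record
    { at        = λ t → at P (j + t)
    ; at∈       = λ t t≤ → at∈ P (j + t) (shifted t≤)
    ; at-inj    = λ a b a≤ b≤ eq → +-cancelˡ-≡ j a b (at-inj P (j + a) (j + b) (shifted a≤) (shifted b≤) eq)
    ; at-adj    = λ t t< → subst (λ x → at P (j + t) ~ at P x) (sym (+-suc j t))
                             (at-adj P (j + t) (subst (_≤ k) (+-suc j t) (shifted t<)))
    ; at-nonadj = λ a b b≤ 1+a<b → at-nonadj P (j + a) (j + b) (shifted b≤)
                             (subst (_≤ j + b) (trans (+-suc j (suc a)) (cong suc (+-suc j a))) (+-monoʳ-≤ j 1+a<b)) }
    where
    shifted : ∀ {t} → t ≤ k ∸ j → j + t ≤ k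
    shifted {t} t≤ = subst (j + t ≤_) (m+[n∸m]≡n j≤k) (+-monoʳ-≤ j t≤)

  offPath : (P : InducedPath T (suc k)) → ∀ {z} → at P (suc k) ~ z → z ≢ at P k → OffPath P z
  offPath {k = k} P {z} last~z z≢prev j j≤1+k j≡z with ≤-suc-split j≤1+k
  ... | inj₂ refl = ~-irrefl last~z j≡z
  ... | inj₁ j≤k with m≤n⇒m<n∨m≡n j≤k
  ...   | inj₂ refl = z≢prev (sym j≡z)
  ...   | inj₁ j<k = at-nonadj P j (suc k) ≤-refl (s≤s j<k) (subst (_~ at P (suc k)) (sym j≡z) (~-sym last~z))

  commonNbr-offPath : (P : InducedPath T (suc k)) → ∀ {z} → at P (suc k) ~ z → at P k ~ z → OffPath P z
  commonNbr-offPath P x~z y~z = offPath P x~z (λ z≡y → ~-irrefl y~z (sym z≡y))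

  length<n : InducedPath T k → k < n
  length<n {k = k} P with suc k ≤? n
  ... | yes k<n = k<n
  ... | no k≮n with pigeonhole (≰⇒> k≮n) (λ i → at P (toℕ i))
  ...   | i , j , i<j , eq = ⊥-elim (<⇒≢ i<j (at-inj P (toℕ i) (toℕ j) (≤-pred (toℕ<n i)) (≤-pred (toℕ<n j)) eq))

module ChordalPaths {n : ℕ} (G : Graph n) (chordal : Chordal G) where
  open GraphNotation G
  open InducedPaths G

  private
    variable
      T : Subset n

  -- An induced path with d ≥ 2 edges together with an outside vertex
  -- adjacent to exactly its two ends is an induced cycle of length d + 2.
  closeCycle : ∀ d → 2 ≤ d → (P : InducedPath T d) → ∀ z → OffPath P z →
               z ~ at P 0 → z ~ at P d → (∀ t → 0 < t → t < d → ¬ z ~ at P t) → ⊥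
  closeCycle (suc (suc m)) (s≤s (s≤s z≤n)) P z off z~first z~last z≁inner =
    chordal (m , c , c-inj , c-adj⇔)
    where
    d = suc (suc m)
    f : ℕ → Fin n
    f = snoc (at P) (suc d) z
    old : ∀ {j} → j ≤ d → f j ≡ at P j
    old j≤d = snoc-old (at P) z (s≤s j≤d)
    new : f (suc d) ≡ z
    new = snoc-new (at P) (suc d) z
    f-inj : ∀ {a b} → a ≤ suc d → b ≤ suc d → f a ≡ f b → a ≡ b
    f-inj {a} {b} a≤ b≤ eq with ≤-suc-split a≤ | ≤-suc-split b≤
    ... | inj₁ a≤d | inj₁ b≤d = at-inj P a b a≤d b≤d (trans (sym (old a≤d)) (trans eq (old b≤d)))
    ... | inj₁ a≤d | inj₂ refl = ⊥-elim (off a a≤d (trans (sym (old a≤d)) (trans eq new)))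
    ... | inj₂ refl | inj₁ b≤d = ⊥-elim (off b b≤d (trans (sym (old b≤d)) (trans (sym eq) new)))
    ... | inj₂ refl | inj₂ refl = refl
    z-ends : ∀ {a} → a ≤ d → at P a ~ z → a ≡ 0 ⊎ a ≡ d
    z-ends {zero} _ _ = inj₁ refl
    z-ends {suc a} a≤d a~z with suc a ≟ d
    ... | yes a≡d = inj₂ a≡d
    ... | no a≢d = ⊥-elim (z≁inner (suc a) (s≤s z≤n) (≤∧≢⇒< a≤d a≢d) (~-sym a~z))
    follows⇒adj : ∀ {a b} → b ≤ suc d → Follows (suc d) a b → f a ~ f b
    follows⇒adj {a} b≤ (inj₁ refl) with ≤-suc-split b≤
    ... | inj₁ a<d = subst₂ _~_ (sym (old (<⇒≤ a<d))) (sym (old a<d)) (at-adj P a a<d)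
    ... | inj₂ refl = subst₂ _~_ (sym (old ≤-refl)) (sym new) (~-sym z~last)
    follows⇒adj _ (inj₂ (refl , refl)) = subst₂ _~_ (sym new) (sym (old z≤n)) z~first
    adj⇒follows : ∀ {a b} → a ≤ suc d → b ≤ suc d → f a ~ f b →
                  Follows (suc d) a b ⊎ Follows (suc d) b a
    adj⇒follows {a} {b} a≤ b≤ a~b with ≤-suc-split a≤ | ≤-suc-split b≤
    ... | inj₁ a≤d | inj₁ b≤d =
          Sum.map inj₁ inj₁ (adj⇒consecutive P a≤d b≤d (subst₂ _~_ (old a≤d) (old b≤d) a~b))
    ... | inj₁ a≤d | inj₂ refl with z-ends a≤d (subst₂ _~_ (old a≤d) new a~b)
    ...   | inj₁ refl = inj₂ (inj₂ (refl , refl))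
    ...   | inj₂ refl = inj₁ (inj₁ refl)
    adj⇒follows a≤ b≤ a~b | inj₂ refl | inj₁ b≤d with z-ends b≤d (~-sym (subst₂ _~_ new (old b≤d) a~b))
    ...   | inj₁ refl = inj₁ (inj₂ (refl , refl))
    ...   | inj₂ refl = inj₂ (inj₁ refl)
    adj⇒follows a≤ b≤ a~b | inj₂ refl | inj₂ refl = ⊥-elim (~-irrefl a~b refl)
    c : Fin (suc (suc d)) → Fin n
    c i = f (toℕ i)
    bound : ∀ (i : Fin (suc (suc d))) → toℕ i ≤ suc d
    bound i = ≤-pred (toℕ<n i)
    c-inj : ∀ {i j} → c i ≡ c j → i ≡ j
    c-inj {i} {j} eq = toℕ-injective (f-inj (bound i) (bound j) eq)
    c-adj⇔ : ∀ i j → c i ~ c j ⇔ CycAdj G m i j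
    c-adj⇔ i j = mk⇔
      (λ i~j → Sum.map (Equivalence.from (suc%⇔Follows (bound i) (bound j)))
                       (Equivalence.from (suc%⇔Follows (bound j) (bound i)))
                       (adj⇒follows (bound i) (bound j) i~j))
      [ (λ i→j → follows⇒adj (bound j) (Equivalence.to (suc%⇔Follows (bound i) (bound j)) i→j)) ,
        (λ j→i → ~-sym (follows⇒adj (bound i) (Equivalence.to (suc%⇔Follows (bound j) (bound i)) j→i))) ]′

  closeCycleFrom : ∀ {K} (P : InducedPath T K) j → suc j < K → ∀ z → OffPath P z →
                   z ~ at P j → z ~ at P K → (∀ t → j < t → t < K → ¬ z ~ at P t) → ⊥
  closeCycleFrom {K = K} P j 1+j<K z off z~j z~K z≁inner =
    closeCycle (K ∸ j) 2≤K∸j (dropFirst P j j≤K) z off' z~first z~last z≁inner'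
    where
    j≤K : j ≤ K
    j≤K = ≤-trans (n≤1+n j) (<⇒≤ 1+j<K)
    j+[K∸j]≡K : j + (K ∸ j) ≡ K
    j+[K∸j]≡K = m+[n∸m]≡n j≤K
    2≤K∸j : 2 ≤ K ∸ j
    2≤K∸j = +-cancelˡ-≤ j 2 (K ∸ j) (subst₂ _≤_ (+-comm 2 j) (sym j+[K∸j]≡K) 1+j<K)
    off' : ∀ t → t ≤ K ∸ j → at P (j + t) ≢ z
    off' t t≤ = off (j + t) (subst (j + t ≤_) j+[K∸j]≡K (+-monoʳ-≤ j t≤))
    z~first : z ~ at P (j + 0)
    z~first = subst (λ x → z ~ at P x) (sym (+-identityʳ j)) z~j
    z~last : z ~ at P (j + (K ∸ j))
    z~last = subst (λ x → z ~ at P x) (sym j+[K∸j]≡K) z~K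
    z≁inner' : ∀ t → 0 < t → t < K ∸ j → ¬ z ~ at P (j + t)
    z≁inner' t 0<t t< = z≁inner (j + t) (subst (_< j + t) (+-identityʳ j) (+-monoʳ-< j 0<t))
                          (subst (suc (j + t) ≤_) j+[K∸j]≡K (subst (_≤ j + (K ∸ j)) (+-suc j t) (+-monoʳ-≤ j t<)))

  -- A vertex z off P adjacent to the last vertex of P either has no other
  -- neighbour on P, or is adjacent to the second-to-last vertex as well:
  -- otherwise its last earlier neighbour would close an induced cycle.
  lastEarlierNeighbour : ∀ {K} (P : InducedPath T K) z → OffPath P z → at P K ~ z →
                         (∀ j → j < K → ¬ at P j ~ z) ⊎ ∃ λ K' → K ≡ suc K' × at P K' ~ z
  lastEarlierNeighbour {K = K} P z off K~z with lastBelow (λ j → at P j ~? z) K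
  ... | inj₁ none = inj₁ none
  ... | inj₂ (j , j<K , j~z , after) with m≤n⇒m<n∨m≡n j<K
  ...   | inj₁ 1+j<K = ⊥-elim (closeCycleFrom P j 1+j<K z off (~-sym j~z) (~-sym K~z)
                                 (λ t j<t t<K z~t → after t j<t t<K (~-sym z~t)))
  ...   | inj₂ refl = inj₂ (j , refl , j~z)

module EdgeDomination {n : ℕ} (G : Graph n) (M : Fin n → Fin n → Bool)
                      (eeds : IsEfficientEdgeDominatingSet G M) where
  open GraphNotation G
  open IsEfficientEdgeDominatingSet eeds

  Partners : Fin n → Fin n → Set
  Partners x y = M x y ≡ true

  Matched : Fin n → Set
  Matched x = ∃ (Partners x)

  matched? : ∀ x → Dec (Matched x)
  matched? x = any? (λ y → M x y ≟ᵇ true)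

  partners-sym : ∀ {x y} → Partners x y → Partners y x
  partners-sym {x} {y} xy = trans (sym (M-sym x y)) xy

  -- Every edge is dominated, so the neighbours of an unmatched vertex are matched.
  unmatched-nbr-matched : ∀ {x y} → x ~ y → ¬ Matched x → Matched y
  unmatched-nbr-matched {x} {y} x~y x-unm with exists x y x~y
  ... | a , b , ab , inj₁ refl = ⊥-elim (x-unm (b , ab))
  ... | a , b , ab , inj₂ (inj₁ refl) = ⊥-elim (x-unm (a , partners-sym ab))
  ... | a , b , ab , inj₂ (inj₂ (inj₁ refl)) = b , ab
  ... | a , b , ab , inj₂ (inj₂ (inj₂ refl)) = a , partners-sym ab

  -- A vertex has at most one partner (the edge of M at x is dominated once).
  partner-unique : ∀ {x y z} → Partners x y → Partners x z → y ≡ z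
  partner-unique {x} {y} {z} xy xz with unique x y (M⊆E x y xy) x y x z xy (inj₁ refl) xz (inj₁ refl)
  ... | inj₁ (_ , y≡z) = y≡z
  ... | inj₂ (_ , y≡x) = ⊥-elim (~-irrefl (M⊆E x y xy) (sym y≡x))

  -- An edge between two matched vertices lies in M (otherwise it is dominated twice).
  matched-edge : ∀ {x y} → x ~ y → Matched x → Matched y → Partners x y
  matched-edge {x} {y} x~y (p , xp) (q , yq)
    with unique x y x~y x p y q xp (inj₁ refl) yq (inj₂ (inj₂ (inj₁ refl)))
  ... | inj₁ (x≡y , _) = ⊥-elim (~-irrefl x~y x≡y)
  ... | inj₂ (_ , refl) = xp

  other-nbr-unmatched : ∀ {u v a} → Partners u v → u ~ a → a ≢ v → ¬ Matched a
  other-nbr-unmatched uv u~a a≢v a-mat = a≢v (sym (partner-unique uv (matched-edge u~a (_ , uv) a-mat)))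

  -- A vertex x with a neighbour y such that x and y have two distinct common
  -- neighbours a, b is matched: otherwise y, a, b are all matched, and y would
  -- have the two partners a and b.
  common-nbrs⇒matched : ∀ {x y a b} → x ~ y → x ~ a → x ~ b → y ~ a → y ~ b → a ≢ b → Matched x
  common-nbrs⇒matched {x} x~y x~a x~b y~a y~b a≢b with matched? x
  ... | yes x-mat = x-mat
  ... | no x-unm = ⊥-elim (a≢b (partner-unique (matched-edge y~a y-mat (nbr x~a)) (matched-edge y~b y-mat (nbr x~b))))
    where
    nbr : ∀ {z} → x ~ z → Matched z
    nbr x~z = unmatched-nbr-matched x~z x-unm
    y-mat = nbr x~y

  common-nbrs⇒partners : ∀ {u v a b} → u ~ v → u ~ a → u ~ b → v ~ a → v ~ b → a ≢ b → Partners u v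
  common-nbrs⇒partners u~v u~a u~b v~a v~b a≢b =
    matched-edge u~v (common-nbrs⇒matched u~v u~a u~b v~a v~b a≢b)
                     (common-nbrs⇒matched (~-sym u~v) v~a v~b u~a u~b a≢b)

  -- No vertex u sees a triangle-sharing configuration  a ~ v ~ b  with an
  -- extra neighbour a' ≢ v of a:  u, v become partners, so a is unmatched,
  -- a' is matched, and then u, a' would be partners too.
  no-dominated-fan : ∀ {u v a b a'} → u ~ v → u ~ a → u ~ b → u ~ a' →
                     v ~ a → v ~ b → a ~ a' → a ≢ b → a' ≢ v → ⊥
  no-dominated-fan u~v u~a u~b u~a' v~a v~b a~a' a≢b a'≢v = a'≢v (sym (partner-unique uv ua'))
    where
    uv = common-nbrs⇒partners u~v u~a u~b v~a v~b a≢b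
    a-unm = other-nbr-unmatched uv u~a (λ a≡v → ~-irrefl v~a (sym a≡v))
    ua' = matched-edge u~a' (_ , uv) (unmatched-nbr-matched a~a' a-unm)

module CycleWindows {n : ℕ} (G : Graph n) where
  open GraphNotation G

  record Window {m : ℕ} (c : Fin (suc (suc (suc (suc m)))) → Fin n)
                (here : Fin (suc (suc (suc (suc m))))) : Set where
    field
      next next² prev : Fin (suc (suc (suc (suc m))))
      here~next  : c here ~ c next
      next~next² : c next ~ c next²
      prev~here  : c prev ~ c here
      next≢prev  : c next ≢ c prev
      next²≢here : c next² ≢ c here
      next²≁here : ¬ c next² ~ c here
      prev≁next  : ¬ c prev ~ c next

  window : ∀ {m c} → IsInducedCycle G m c → ∀ j → Window c j
  window {m} {c} (c-inj , c-adj⇔) j = subst (Window c) pos-0 (record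
    { next       = pos 1
    ; next²      = pos 2
    ; prev       = pos (3 + m)
    ; here~next  = adj-pos 0 1 refl
    ; next~next² = adj-pos 1 2 refl
    ; prev~here  = adj-pos (3 + m) 0 (trans ([m+n]%n≡m%n r K) (cong (_% K) (sym (+-identityʳ r))))
    ; next≢prev  = λ eq → %-distinct r K (s≤s (s≤s z≤n)) (s≤s (s≤s (s≤s (s≤s (n≤1+n m))))) (pos-≡ 1 (3 + m) eq)
    ; next²≢here = λ eq → %-distinct r K (s≤s z≤n) (s≤s (s≤s (s≤s z≤n))) (sym (pos-≡ 2 0 eq))
    ; next²≁here = λ adj → [ (λ eq → %-distinct r K (s≤s z≤n) (s≤s (s≤s (s≤s (s≤s z≤n)))) (sym eq)) ,
                              %-distinct r K (s≤s (s≤s z≤n)) (s≤s (s≤s (s≤s z≤n))) ]′ (pos-adj 2 0 adj)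
    ; prev≁next  = λ adj → [ (λ eq → %-distinct r K (s≤s (s≤s z≤n)) ≤-refl (sym eq)) ,
                              %-distinct r K (s≤s (s≤s (s≤s z≤n))) (s≤s (s≤s (s≤s (s≤s (m≤n+m m 2))))) ]′
                            (pos-adj (3 + m) 1 adj) })
    where
    open ≡-Reasoning
    K = suc (suc (suc (suc m)))
    r = toℕ j
    pos : ℕ → Fin K
    pos t = fromℕ< (m%n<n (r + t) K)
    toℕ-pos : ∀ t → toℕ (pos t) ≡ (r + t) % K
    toℕ-pos t = toℕ-fromℕ< _
    pos-0 : pos 0 ≡ j
    pos-0 = toℕ-injective (trans (toℕ-pos 0) (trans (cong (_% K) (+-identityʳ r)) (m<n⇒m%n≡m (toℕ<n j))))
    suc-pos : ∀ s → suc (toℕ (pos s)) % K ≡ (r + suc s) % K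
    suc-pos s = begin
      suc (toℕ (pos s)) % K  ≡⟨ cong (λ x → suc x % K) (toℕ-pos s) ⟩
      suc ((r + s) % K) % K  ≡⟨ suc-% (r + s) K ⟩
      suc (r + s) % K        ≡⟨ cong (_% K) (sym (+-suc r s)) ⟩
      (r + suc s) % K        ∎
    adj-pos : ∀ s t → (r + suc s) % K ≡ (r + t) % K → c (pos s) ~ c (pos t)
    adj-pos s t eq = Equivalence.from (c-adj⇔ (pos s) (pos t))
                       (inj₁ (trans (suc-pos s) (trans eq (sym (toℕ-pos t)))))
    pos-adj : ∀ s t → c (pos s) ~ c (pos t) → (r + suc s) % K ≡ (r + t) % K ⊎ (r + suc t) % K ≡ (r + s) % K
    pos-adj s t adj with Equivalence.to (c-adj⇔ (pos s) (pos t)) adj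
    ... | inj₁ eq = inj₁ (trans (sym (suc-pos s)) (trans eq (toℕ-pos t)))
    ... | inj₂ eq = inj₂ (trans (sym (suc-pos t)) (trans eq (toℕ-pos s)))
    pos-≡ : ∀ s t → c (pos s) ≡ c (pos t) → (r + s) % K ≡ (r + t) % K
    pos-≡ s t eq = trans (sym (toℕ-pos s)) (trans (cong toℕ (c-inj eq)) (toℕ-pos t))

module DuallyChordalIsChordal {n : ℕ} (G : Graph n) (M : Fin n → Fin n → Bool)
                              (eeds : IsEfficientEdgeDominatingSet G M) where
  open GraphNotation G
  open CycleWindows G
  open EdgeDomination G M eeds

  -- Let v be the vertex of an induced cycle that comes first in a maximum
  -- neighbourhood ordering, with cycle neighbours a, b and second neighbour a'.
  -- All of them lie in the suffix starting at v, so v's maximum neighbour u is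
  -- adjacent to v, a, b, a' — a configuration excluded by no-dominated-fan.
  dually-chordal⇒chordal : DuallyChordal G → Chordal G
  dually-chordal⇒chordal (π , mno) (m , c , cycle) =
    no-dominated-fan u~v u~a u~b u~a' here~next (~-sym prev~here) next~next² next≢prev next²≢here
    where
    first = argmin (λ j → toℕ (π ⟨$⟩ˡ c j))
    j₀ = proj₁ first
    i = π ⟨$⟩ˡ c j₀
    open Window (window cycle j₀)
    u = proj₁ (mno i)
    dominates : ∀ tw tz → c tw ∈N[ c j₀ ] → c tz ∈N[ c tw ] → c tz ∈N[ u ]
    dominates tw tz w∈Nv z∈Nw =
      proj₂ (proj₂ (proj₂ (mno i))) (c tw) (proj₂ first tw) (subst (c tw ∈N[_]) (sym (inverseʳ π)) w∈Nv)
                                    (c tz) (proj₂ first tz) z∈Nw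
    v∈Nu = dominates j₀ j₀ (inj₁ refl) (inj₁ refl)
    a∈Nu = dominates j₀ next (inj₁ refl) (inj₂ (~-sym here~next))
    b∈Nu = dominates j₀ prev (inj₁ refl) (inj₂ prev~here)
    a'∈Nu = dominates next next² (inj₂ (~-sym here~next)) (inj₂ (~-sym next~next²))
    u~v = ∈N-separated⇒~ v∈Nu a'∈Nu next²≢here next²≁here
    u~a = ∈N-separated⇒~ a∈Nu b∈Nu (λ eq → next≢prev (sym eq)) prev≁next
    u~b = ∈N-separated⇒~ b∈Nu a∈Nu next≢prev (λ adj → prev≁next (~-sym adj))
    u~a' = ∈N-separated⇒~ a'∈Nu v∈Nu (λ eq → next²≢here (sym eq)) (λ adj → next²≁here (~-sym adj))

module ChordalHasMaxNeighbours {n : ℕ} (G : Graph n) (chordal : Chordal G)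
                               (M : Fin n → Fin n → Bool) (eeds : IsEfficientEdgeDominatingSet G M) where
  open GraphNotation G
  open InducedPaths G
  open ChordalPaths G chordal
  open EdgeDomination G M eeds

  -- Suppose no vertex of T has a maximum neighbour in G[T].  We show that every
  -- induced path of G[T] extends by one edge; as induced paths have fewer than
  -- n edges, G[T] then has no vertex at all.  Below, the hypothesis `longer`
  -- says that G[T] has no induced path one edge longer than the path P at hand,
  -- whose last vertices are  …, a, y, x.
  module WithoutMaxNeighbour (T : Subset n) (noMax : ∀ v → v ∈ T → ¬ HasMaxNeighbourIn (_∈ T) v) where

    -- A neighbour s ≢ y of x in T is adjacent to y: it cannot extend P.
    neighbourOfEnd : ∀ {k} → ¬ InducedPath T (suc (suc k)) → (P : InducedPath T (suc k)) →
                     ∀ s → s ∈ T → at P (suc k) ~ s → s ≢ at P k → at P k ~ s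
    neighbourOfEnd longer P s s∈T x~s s≢y with lastEarlierNeighbour P s (offPath P x~s s≢y) x~s
    ... | inj₁ only = ⊥-elim (longer (extend P s s∈T (offPath P x~s s≢y) x~s only))
    ... | inj₂ (_ , refl , y~s) = y~s

    -- If the last vertex r of P is unmatched and not adjacent to the partner y
    -- of its predecessor q, then q is the only neighbour of r in T, hence its
    -- maximum neighbour: another neighbour s would be adjacent to q
    -- (neighbourOfEnd) and matched, hence q's partner y — but r ≁ y.
    lonely-end : ∀ {k} → ¬ InducedPath T (suc (suc k)) → (P : InducedPath T (suc k)) →
                 ∀ {q r y} → at P k ≡ q → at P (suc k) ≡ r → Partners q y → ¬ Matched r → ¬ y ~ r →
                 MaxNeighbourIn (_∈ T) r q
    lonely-end {k} longer P refl refl qy r-unm y≁r =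
      pendant⇒max (at∈ P k (n≤1+n k)) (~-sym (at-adj P k ≤-refl)) only-q
      where
      only-q : ∀ s → s ∈ T → at P (suc k) ~ s → s ≡ at P k
      only-q s s∈T r~s with s ≟ᶠ at P k
      ... | yes s≡q = s≡q
      ... | no s≢q = ⊥-elim (y≁r (subst (_~ at P (suc k)) (sym (partner-unique qy qs)) (~-sym r~s)))
        where
        qs = matched-edge (neighbourOfEnd longer P s s∈T r~s s≢q) (_ , qy) (unmatched-nbr-matched r~s r-unm)

    -- If q ∈ T off P is adjacent to a, y and x, then no neighbour r ∈ T of q
    -- lies outside N[y].  Indeed q and y are partners, so a and r are
    -- unmatched and r ≁ a.  By chordality, q sees no vertex before a (the
    -- one just before a would be a second unmatched neighbour of a), so
    -- …, a, q  and then  …, a, q, r  are induced paths; the last one is as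
    -- long as P and cannot be extended, so lonely-end gives r a maximum
    -- neighbour.
    no-escape-near : ∀ {j} → ¬ InducedPath T (suc (suc (suc j))) → (P : InducedPath T (suc (suc j))) →
                     ∀ q r → q ∈ T → r ∈ T → OffPath P q →
                     at P j ~ q → at P (suc j) ~ q → at P (suc (suc j)) ~ q →
                     q ~ r → r ≢ at P (suc j) → ¬ at P (suc j) ~ r → ⊥
    no-escape-near {j} longer P q r q∈T r∈T q-off a~q y~q x~q q~r r≢y y≁r =
      attach-q (lastEarlierNeighbour P₀ q q-off₀ a~q)
      where
      a = at P j
      y = at P (suc j)
      j≤2+j : j ≤ suc (suc j)
      j≤2+j = ≤-trans (n≤1+n j) (n≤1+n (suc j))
      a~y : a ~ y
      a~y = at-adj P j (n≤1+n (suc j))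
      a≢x : a ≢ at P (suc (suc j))
      a≢x eq = <⇒≢ (n≤1+n (suc j)) (at-inj P j (suc (suc j)) j≤2+j ≤-refl eq)
      qy : Partners q y
      qy = common-nbrs⇒partners (~-sym y~q) (~-sym a~q) (~-sym x~q) (~-sym a~y) (at-adj P (suc j) ≤-refl) a≢x
      a-unm : ¬ Matched a
      a-unm = other-nbr-unmatched qy (~-sym a~q) (~-irrefl a~y)
      r-unm : ¬ Matched r
      r-unm = other-nbr-unmatched qy q~r r≢y
      P₀ = truncate P j j≤2+j
      q-off₀ = truncate-offPath P j≤2+j q-off
      attach-q : (∀ t → t < j → ¬ at P t ~ q) ⊎ ∃ (λ t → j ≡ suc t × at P t ~ q) → ⊥
      attach-q (inj₂ (t , j≡1+t , t~q)) = a-unm (unmatched-nbr-matched t~a t-unm)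
        where
        t<2+j : t < suc (suc j)
        t<2+j = subst (_≤ suc (suc j)) j≡1+t j≤2+j
        t~a : at P t ~ a
        t~a = subst (λ i → at P t ~ at P i) (sym j≡1+t) (at-adj P t t<2+j)
        t-unm : ¬ Matched (at P t)
        t-unm = other-nbr-unmatched qy (~-sym t~q) λ eq →
          <⇒≢ (n≤1+n (suc t)) (trans (at-inj P t (suc j) (<⇒≤ t<2+j) (n≤1+n (suc j)) eq) (cong suc j≡1+t))
      attach-q (inj₁ only) = attach-r (lastEarlierNeighbour P₁ r r-off₁ q~r₁)
        where
        P₁ = extend P₀ q q∈T q-off₀ a~q only
        P₁-q : at P₁ (suc j) ≡ q
        P₁-q = extend-new P₀ q q∈T q-off₀ a~q only
        P₁-a : at P₁ j ≡ a
        P₁-a = extend-old P₀ q q∈T q-off₀ a~q only ≤-refl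
        q~r₁ : at P₁ (suc j) ~ r
        q~r₁ = subst (_~ r) (sym P₁-q) q~r
        r-off₁ : OffPath P₁ r
        r-off₁ = offPath P₁ q~r₁ (λ r≡a₁ → y≁r (~-sym (subst (_~ y) (sym (trans r≡a₁ P₁-a)) a~y)))
        attach-r : (∀ t → t < suc j → ¬ at P₁ t ~ r) ⊎ ∃ (λ t → suc j ≡ suc t × at P₁ t ~ r) → ⊥
        attach-r (inj₂ (_ , refl , a~r₁)) = r-unm (unmatched-nbr-matched (subst (_~ r) P₁-a a~r₁) a-unm)
        attach-r (inj₁ only₁) = noMax r r∈T (q , lonely-end longer P₂ P₂-q P₂-r qy r-unm y≁r)
          where
          P₂ = extend P₁ r r∈T r-off₁ q~r₁ only₁
          P₂-r : at P₂ (suc (suc j)) ≡ r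
          P₂-r = extend-new P₁ r r∈T r-off₁ q~r₁ only₁
          P₂-q : at P₂ (suc j) ≡ q
          P₂-q = trans (extend-old P₁ r r∈T r-off₁ q~r₁ only₁ ≤-refl) P₁-q

    -- Let q ∈ T be a common neighbour of x and y.  Then no neighbour r ∈ T of q
    -- lies outside N[y]: if q is adjacent to a this is no-escape-near;
    -- otherwise  …, y, q  is an induced path P₁ as long as P, and
    -- neighbourOfEnd applied to P₁ makes r adjacent to y.
    no-escape : ∀ {k} → ¬ InducedPath T (suc (suc k)) → (P : InducedPath T (suc k)) →
                ∀ q r → q ∈ T → r ∈ T → at P (suc k) ~ q → at P k ~ q →
                q ~ r → r ≢ at P k → ¬ at P k ~ r → ⊥
    no-escape {k} longer P q r q∈T r∈T x~q y~q q~r r≢y y≁r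
      with lastEarlierNeighbour (truncate P k (n≤1+n k)) q
             (truncate-offPath P (n≤1+n k) (commonNbr-offPath P x~q y~q)) y~q
    ... | inj₂ (_ , refl , a~q) =
          no-escape-near longer P q r q∈T r∈T (commonNbr-offPath P x~q y~q) a~q y~q x~q q~r r≢y y≁r
    ... | inj₁ only = y≁r (subst (_~ r) P₁-y (neighbourOfEnd longer P₁ r r∈T q~r₁ (λ r≡y₁ → r≢y (trans r≡y₁ P₁-y))))
      where
      P₀ = truncate P k (n≤1+n k)
      q-off₀ = truncate-offPath P (n≤1+n k) (commonNbr-offPath P x~q y~q)
      P₁ = extend P₀ q q∈T q-off₀ y~q only
      P₁-y : at P₁ k ≡ at P k
      P₁-y = extend-old P₀ q q∈T q-off₀ y~q only ≤-refl
      q~r₁ : at P₁ (suc k) ~ r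
      q~r₁ = subst (_~ r) (sym (extend-new P₀ q q∈T q-off₀ y~q only)) q~r

    N[x]⊆N[y] : ∀ {k} → ¬ InducedPath T (suc (suc k)) → (P : InducedPath T (suc k)) →
                ∀ z → z ∈ T → z ∈N[ at P (suc k) ] → z ∈N[ at P k ]
    N[x]⊆N[y] {k} longer P z z∈T (inj₁ refl) = inj₂ (~-sym (at-adj P k ≤-refl))
    N[x]⊆N[y] {k} longer P z z∈T (inj₂ z~x) with z ≟ᶠ at P k
    ... | yes z≡y = inj₁ z≡y
    ... | no z≢y = inj₂ (~-sym (neighbourOfEnd longer P z z∈T (~-sym z~x) z≢y))

    -- If P cannot be extended, its last vertex x has a maximum neighbour in
    -- G[T]: x itself if P is a single vertex (then x is isolated in G[T],
    -- as a neighbour would extend P), and otherwise its predecessor y.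
    end-has-max : ∀ {k} → ¬ InducedPath T (suc k) → (P : InducedPath T k) → HasMaxNeighbourIn (_∈ T) (at P k)
    end-has-max {zero} longer P = at P 0 , isolated⇒max (at∈ P 0 z≤n) isolated
      where
      isolated : ∀ s → s ∈ T → ¬ at P 0 ~ s
      isolated s s∈T x~s = longer (extend P s s∈T (λ { .0 z≤n → ~-irrefl x~s }) x~s (λ j ()))
    end-has-max {suc k} longer P = at P k , at∈ P k (n≤1+n k) , inj₂ (at-adj P k ≤-refl) , dominated
      where
      x = at P (suc k)
      y = at P k
      dominated : ∀ w → w ∈ T → w ∈N[ x ] → ∀ z → z ∈ T → z ∈N[ w ] → z ∈N[ y ]
      dominated w w∈T (inj₁ refl) z z∈T z∈Nx = N[x]⊆N[y] longer P z z∈T z∈Nx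
      dominated w w∈T (inj₂ w~x) z z∈T z∈Nw with w ≟ᶠ y | z ∈N?[ y ]
      ... | yes refl | _ = z∈Nw
      ... | no _ | yes z∈Ny = z∈Ny
      ... | no w≢y | no z∉Ny = ⊥-elim (escape z∈Nw)
        where
        y~w : y ~ w
        y~w = neighbourOfEnd longer P w w∈T (~-sym w~x) w≢y
        escape : z ∈N[ w ] → ⊥
        escape (inj₁ refl) = z∉Ny (inj₂ (~-sym y~w))
        escape (inj₂ z~w) = no-escape longer P w z w∈T z∈T (~-sym w~x) y~w (~-sym z~w)
                              (λ z≡y → z∉Ny (inj₁ z≡y)) (λ y~z → z∉Ny (inj₂ (~-sym y~z)))

    no-induced-path : ∀ f {k} → n ≤ k + f → ¬ InducedPath T k
    no-induced-path zero {k} n≤k P = <⇒≱ (length<n P) (subst (n ≤_) (+-identityʳ k) n≤k)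
    no-induced-path (suc f) {k} n≤k+1+f P =
      noMax (at P k) (at∈ P k ≤-refl) (end-has-max (no-induced-path f (subst (n ≤_) (+-suc k f) n≤k+1+f)) P)

    empty : ∀ x → x ∈ T → ⊥
    empty x x∈T = no-induced-path n ≤-refl (record
      { at        = λ _ → x
      ; at∈       = λ _ _ → x∈T
      ; at-inj    = λ { .0 .0 z≤n z≤n _ → refl }
      ; at-adj    = λ i ()
      ; at-nonadj = λ { i .0 z≤n () } })

  hasMax? : ∀ T v → Dec (HasMaxNeighbourIn (_∈ T) v)
  hasMax? T v = any? λ u → (u ∈? T) ×-dec (u ∈N?[ v ]) ×-dec
                  all? (λ w → (w ∈? T) →-dec ((w ∈N?[ v ]) →-dec
                    all? (λ z → (z ∈? T) →-dec ((z ∈N?[ w ]) →-dec (z ∈N?[ u ])))))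

  maxNeighbourExists : ∀ T x → x ∈ T → ∃ λ v → v ∈ T × HasMaxNeighbourIn (_∈ T) v
  maxNeighbourExists T x x∈T with any? (λ v → (v ∈? T) ×-dec hasMax? T v)
  ... | yes found = found
  ... | no none = ⊥-elim (WithoutMaxNeighbour.empty T (λ v v∈T max → none (v , v∈T , max)) x x∈T)

module MaxNeighbourhoodOrderings {n : ℕ} (G : Graph n) where
  open GraphNotation G

  ListedFrom : ∀ {r} → (Fin r → Fin n) → Fin r → Fin n → Set
  ListedFrom e i x = ∃ λ j → i ≤ᶠ j × e j ≡ x

  record Elimination (p : Subset n) (r : ℕ) : Set where
    field
      vertex      : Fin r → Fin n
      vertex∈     : ∀ i → vertex i ∈ p
      vertex-inj  : ∀ {i j} → vertex i ≡ vertex j → i ≡ j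
      vertex-onto : ∀ x → x ∈ p → ∃ λ i → vertex i ≡ x
      vertex-max  : ∀ i → HasMaxNeighbourIn (ListedFrom vertex i) (vertex i)

  module _ (maxExists : ∀ T x → x ∈ T → ∃ λ v → v ∈ T × HasMaxNeighbourIn (_∈ T) v) where

    elimination : ∀ r (p : Subset n) → ∣ p ∣ ≡ r → Elimination p r
    elimination zero p size = record
      { vertex      = λ ()
      ; vertex∈     = λ ()
      ; vertex-inj  = λ { {()} }
      ; vertex-onto = λ x x∈p → ⊥-elim (0≢1+n (trans (sym size) (∣p∣≡1+∣p-x∣ x∈p)))
      ; vertex-max  = λ () }
    elimination (suc r) p size = record
      { vertex      = vertex
      ; vertex∈     = vertex∈
      ; vertex-inj  = vertex-inj
      ; vertex-onto = vertex-onto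
      ; vertex-max  = vertex-max }
      where
      nonempty : ∃ λ x → x ∈ p
      nonempty with nonempty? p
      ... | yes ne = ne
      ... | no empty = ⊥-elim (0≢1+n (trans (sym (trans (cong ∣_∣ (Empty-unique empty)) (∣⊥∣≡0 n))) size))
      chosen = maxExists p (proj₁ nonempty) (proj₂ nonempty)
      v = proj₁ chosen
      v∈p = proj₁ (proj₂ chosen)
      rest = elimination r (p - v) (suc-injective (trans (sym (∣p∣≡1+∣p-x∣ v∈p)) size))
      module R = Elimination rest
      vertex : Fin (suc r) → Fin n
      vertex fzero = v
      vertex (fsuc i) = R.vertex i
      later≢v : ∀ i → R.vertex i ≢ v
      later≢v i eq = x∉p-x v p (subst (_∈ p - v) eq (R.vertex∈ i))
      vertex∈ : ∀ i → vertex i ∈ p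
      vertex∈ fzero = v∈p
      vertex∈ (fsuc i) = p─q⊆p p _ (R.vertex∈ i)
      vertex-inj : ∀ {i j} → vertex i ≡ vertex j → i ≡ j
      vertex-inj {fzero} {fzero} _ = refl
      vertex-inj {fzero} {fsuc j} eq = ⊥-elim (later≢v j (sym eq))
      vertex-inj {fsuc i} {fzero} eq = ⊥-elim (later≢v i eq)
      vertex-inj {fsuc i} {fsuc j} eq = cong fsuc (R.vertex-inj eq)
      vertex-onto : ∀ x → x ∈ p → ∃ λ i → vertex i ≡ x
      vertex-onto x x∈p with x ≟ᶠ v
      ... | yes refl = fzero , refl
      ... | no x≢v = let (i , eq) = R.vertex-onto x (x∈p∧x≢y⇒x∈p-y x∈p x≢v) in fsuc i , eq
      vertex-max : ∀ i → HasMaxNeighbourIn (ListedFrom vertex i) (vertex i)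
      vertex-max fzero = HasMaxNeighbourIn-cong
        (λ x x∈p → let (j , eq) = vertex-onto x x∈p in j , z≤n , eq)
        (λ { x (j , _ , refl) → vertex∈ j })
        (proj₂ (proj₂ chosen))
      vertex-max (fsuc i) = HasMaxNeighbourIn-cong
        (λ { x (j , i≤j , eq) → fsuc j , s≤s i≤j , eq })
        (λ { x (fzero , () , _) ; x (fsuc j , s≤s i≤j , eq) → j , i≤j , eq })
        (R.vertex-max i)

    -- An elimination of all vertices is a maximum neighbourhood ordering: the
    -- suffix G_i consists exactly of the vertices listed from position i on.
    dually-chordal : DuallyChordal G
    dually-chordal = π , λ i → HasMaxNeighbourIn-cong (listed⇒suffix i) (suffix⇒listed i) (vertex-max i)
      where
      open Elimination (elimination n ⊤ (∣⊤∣≡n n))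
      position : Fin n → Fin n
      position x = proj₁ (vertex-onto x ∈⊤)
      vertex-position : ∀ x → vertex (position x) ≡ x
      vertex-position x = proj₂ (vertex-onto x ∈⊤)
      position-vertex : ∀ i → position (vertex i) ≡ i
      position-vertex i = vertex-inj (vertex-position (vertex i))
      π = permutation vertex position vertex-position position-vertex
      listed⇒suffix : ∀ i x → ListedFrom vertex i x → InSuffix G π i x
      listed⇒suffix i x (j , i≤j , refl) = subst (i ≤ᶠ_) (sym (position-vertex j)) i≤j
      suffix⇒listed : ∀ i x → InSuffix G π i x → ListedFrom vertex i x
      suffix⇒listed i x i≤pos = position x , i≤pos , vertex-position x

lemma6 : (n : ℕ) (G : Graph n) → HasEfficientEdgeDominatingSet G →
    (Chordal G ⇔ DuallyChordal G)
lemma6 n G (M , eeds) = mk⇔ chordal⇒dually-chordal (DuallyChordalIsChordal.dually-chordal⇒chordal G M eeds)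
  where
  chordal⇒dually-chordal : Chordal G → DuallyChordal G
  chordal⇒dually-chordal chordal =
    MaxNeighbourhoodOrderings.dually-chordal G (ChordalHasMaxNeighbours.maxNeighbourExists G chordal M eeds)
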